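{- Let $\mathsf{T}$ be a set functor that preserves weak pullbacks and preserves finite sets. Then the set of all Moss liftings for $\mathsf{T}$ (of all arities $n\in\omega$) is expressively complete.
   Context: Set functors are endofunctors on sets assumed to map injective maps to injective maps; $\mathcal{Q}$ is the contravariant powerset functor. $\mathsf{T}$ preserves finite sets if $\mathsf{T}X$ is finite whenever $X$ is. $\mathsf{T}$ preserves weak pullbacks if for all maps $f_1:X_1\to Y$, $f_2:X_2\to Y$ and $\alpha_i\in\mathsf{T}X_i$ with $\mathsf{T}f_1(\alpha_1)=\mathsf{T}f_2(\alpha_2)$, there is $\gamma\in\mathsf{T}R$ with $\mathsf{T}\pi_i(\gamma)=\alpha_i$, where $R=\{(u,v)\mid f_1(u)=f_2(v)\}$ with projections $\pi_1,\pi_2$. The Barr extension of a relation $R\subseteq X_1\times X_2$ is $\overline{\mathsf{T}}R=\{(\mathsf{T}\pi_1(\gamma),\mathsf{T}\pi_2(\gamma))\mid\gamma\in\mathsf{T}R\}$. For $\alpha\in\mathsf{T}\{1,\dots,n\}$, the $n$-ary Moss lifting $\langle\alpha\rangle$ is given by $\langle\alpha\rangle_X(Z_1,\dots,Z_n)=\{\beta\in\mathsf{T}X\mid(\beta,\alpha)\in\overline{\mathsf{T}}R\}$ where $R=\{(u,k)\in X\times\{1..n\}\mid u\in Z_k\}$. A predicate lifting over a finite set $A$ is a natural transformation $\lambda:\mathcal{Q}^A\to\mathcal{Q}\circ\mathsf{T}$ (i.e. maps $\lambda_X:(\mathcal{P}X)^A\to\mathcal{P}\mathsf{T}X$ with $\lambda_X(\mathcal{Q}f\circ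 V)=(\mathsf{T}f)^{ -1}(\lambda_Y(V))$), monotone if $V(a)\subseteq V'(a)$ for all $a$ implies $\lambda_X(V)\subseteq\lambda_X(V')$; dual $\lambda^d_X(V)=\mathsf{T}X\setminus\lambda_X(X\setminus V(\cdot))$. A one-step model over $A$ is $(X,\alpha,V)$, $\alpha\in\mathsf{T}X$, $V:A\to\mathcal{P}X$. $\mathtt{Latt}(A)$: $\psi::=\bot\mid\top\mid a\mid\psi\vee\psi\mid\psi\wedge\psi$ with truth sets $\|\psi\|_V$. For a set $\Lambda$ of liftings, $\mathtt{1ML}_\Lambda(A)$: $\varphi::=\bot\mid\top\mid\lambda(\psi_1..\psi_n)\mid\lambda^d(\psi_1..\psi_n)\mid\varphi\vee\varphi\mid\varphi\wedge\varphi$ ($\lambda\in\Lambda$, $\psi_i\in\mathtt{Latt}(A)$), with $(X,\alpha,V)\Vdash_1\lambda(\psi_1..\psi_n)$ iff $\alpha\in\lambda_X(\|\psi_1\|_V,..,\|\psi_n\|_V)$. $\Lambda$ is expressively complete if for every finite $A$ every monotone predicate lifting $\lambda$ over $A$ is $\Lambda$-definable: there is $\varphi\in\mathtt{1ML}_\Lambda(A)$ with $\alpha\in\lambda_X(V)$ iff $(X,\alpha,V)\Vdash_1\varphi$ for all one-step models $(X,\alpha,V)$. -}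

module Defs where

open import Level using (0ℓ)
open import Data.Nat using (ℕ)
open import Data.Fin using (Fin)
open import Data.Product using (Σ; ∃; _×_; _,_; proj₁; proj₂)
open import Data.Sum using (_⊎_)
open import Data.Unit using (⊤)
open import Data.Empty using (⊥)
open import Relation.Nullary using (¬_)
open import Relation.Unary using (Pred)
open import Relation.Binary.PropositionalEquality using (_≡_; _≗_)
open import Function using (_∘_; id; _↔_)
open import Function.Definitions using (Injective)

-- Sets are types in Set, subsets are predicates Pred X 0ℓ.
-- Functor laws are stated pointwise; fmap respects pointwise-equal maps
-- (functions between sets are extensional).  As in the paper, set functors
-- are assumed to map injective maps to injective maps.

record SetFunctor : Set₁ where
  field
    F        : Set → Set
    fmap     : {A B : Set} → (A → B) → F A → F B
    fmap-cong : {A B : Set} {f g : A → B} → f ≗ g → fmap f ≗ fmap g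
    fmap-id  : {A : Set} (x : F A) → fmap id x ≡ x
    fmap-∘   : {A B C : Set} (f : A → B) (g : B → C) (x : F A) →
               fmap (g ∘ f) x ≡ fmap g (fmap f x)
    fmap-inj : {A B : Set} {f : A → B} →
               Injective _≡_ _≡_ f → Injective _≡_ _≡_ (fmap f)

open SetFunctor public

IsFinite : Set → Set
IsFinite X = ∃ λ n → X ↔ Fin n

PreservesFiniteSets : SetFunctor → Set₁
PreservesFiniteSets T = (X : Set) → IsFinite X → IsFinite (F T X)

PB : {X₁ X₂ Y : Set} → (X₁ → Y) → (X₂ → Y) → Set
PB {X₁} {X₂} f₁ f₂ = Σ (X₁ × X₂) λ p → f₁ (proj₁ p) ≡ f₂ (proj₂ p)

PreservesWeakPullbacks : SetFunctor → Set₁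
PreservesWeakPullbacks T =
  {X₁ X₂ Y : Set} (f₁ : X₁ → Y) (f₂ : X₂ → Y)
  (α₁ : F T X₁) (α₂ : F T X₂) →
  fmap T f₁ α₁ ≡ fmap T f₂ α₂ →
  Σ (F T (PB f₁ f₂)) λ γ →
    (fmap T (proj₁ ∘ proj₁) γ ≡ α₁) × (fmap T (proj₂ ∘ proj₁) γ ≡ α₂)

RelSet : {X₁ X₂ : Set} → (X₁ → X₂ → Set) → Set
RelSet {X₁} {X₂} R = Σ (X₁ × X₂) λ p → R (proj₁ p) (proj₂ p)

Barr : (T : SetFunctor) {X₁ X₂ : Set} → (X₁ → X₂ → Set) →
       F T X₁ → F T X₂ → Set
Barr T R a₁ a₂ = Σ (F T (RelSet R)) λ γ →
  (fmap T (proj₁ ∘ proj₁) γ ≡ a₁) × (fmap T (proj₂ ∘ proj₁) γ ≡ a₂)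

Moss : (T : SetFunctor) {n : ℕ} → F T (Fin n) →
       {X : Set} → (Fin n → Pred X 0ℓ) → Pred (F T X) 0ℓ
Moss T α Z β = Barr T (λ u k → Z k u) β α

preimage : {X Y : Set} → (X → Y) → Pred Y 0ℓ → Pred X 0ℓ
preimage f P x = P (f x)

record PredLifting (T : SetFunctor) (k : ℕ) : Set₁ where
  field
    lift    : {X : Set} → (Fin k → Pred X 0ℓ) → Pred (F T X) 0ℓ
    natural : {X Y : Set} (f : X → Y) (V : Fin k → Pred Y 0ℓ) (t : F T X) →
              (lift (λ a → preimage f (V a)) t → lift V (fmap T f t)) ×
              (lift V (fmap T f t) → lift (λ a → preimage f (V a)) t)

open PredLifting public

Monotone : {T : SetFunctor} {k : ℕ} → PredLifting T k → Set₁
Monotone {T} {k} l =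
  {X : Set} (V V′ : Fin k → Pred X 0ℓ) →
  ((a : Fin k) (x : X) → V a x → V′ a x) →
  (t : F T X) → lift l V t → lift l V′ t

data Latt (k : ℕ) : Set where
  ⊥L ⊤L : Latt k
  var   : Fin k → Latt k
  _∨L_ _∧L_ : Latt k → Latt k → Latt k

⟦_⟧L : {k : ℕ} {X : Set} → Latt k → (Fin k → Pred X 0ℓ) → Pred X 0ℓ
⟦ ⊥L ⟧L V x = ⊥
⟦ ⊤L ⟧L V x = ⊤
⟦ var a ⟧L V x = V a x
⟦ ψ ∨L ψ′ ⟧L V x = ⟦ ψ ⟧L V x ⊎ ⟦ ψ′ ⟧L V x
⟦ ψ ∧L ψ′ ⟧L V x = ⟦ ψ ⟧L V x × ⟦ ψ′ ⟧L V x

-- 1ML_Λ(A) where Λ = all Moss liftings ⟨α⟩, α ∈ T(Fin n), n ∈ ω.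
-- A modal atom is  ⟨α⟩(ψ₁,…,ψₙ)  or its dual  ⟨α⟩ᵈ(ψ₁,…,ψₙ).

data MossML (T : SetFunctor) (k : ℕ) : Set where
  ⊥M ⊤M : MossML T k
  mossM  : (n : ℕ) → F T (Fin n) → (Fin n → Latt k) → MossML T k
  mossDM : (n : ℕ) → F T (Fin n) → (Fin n → Latt k) → MossML T k
  _∨M_ _∧M_ : MossML T k → MossML T k → MossML T k

dualLift : {T : SetFunctor} {X : Set} {n : ℕ} →
           ((Fin n → Pred X 0ℓ) → Pred (F T X) 0ℓ) →
           (Fin n → Pred X 0ℓ) → Pred (F T X) 0ℓ
dualLift l V t = ¬ l (λ i x → ¬ V i x) t

_,_,_⊩₁_ : {T : SetFunctor} {k : ℕ} (X : Set) → F T X →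
           (Fin k → Pred X 0ℓ) → MossML T k → Set
X , β , V ⊩₁ ⊥M = ⊥
X , β , V ⊩₁ ⊤M = ⊤
_,_,_⊩₁_ {T} X β V (mossM n α ψs) = Moss T α (λ i → ⟦ ψs i ⟧L V) β
_,_,_⊩₁_ {T} X β V (mossDM n α ψs) =
  dualLift {T} (Moss T α) (λ i → ⟦ ψs i ⟧L V) β
X , β , V ⊩₁ (φ ∨M φ′) = (X , β , V ⊩₁ φ) ⊎ (X , β , V ⊩₁ φ′)
X , β , V ⊩₁ (φ ∧M φ′) = (X , β , V ⊩₁ φ) × (X , β , V ⊩₁ φ′)

MossDefinable : (T : SetFunctor) {k : ℕ} → PredLifting T k → Set₁
MossDefinable T {k} l = Σ (MossML T k) λ φ →
  (X : Set) (β : F T X) (V : Fin k → Pred X 0ℓ) →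
  (lift l V β → X , β , V ⊩₁ φ) × (X , β , V ⊩₁ φ → lift l V β)

MossExpressivelyComplete : SetFunctor → Set₁
MossExpressivelyComplete T =
  (k : ℕ) (l : PredLifting T k) → Monotone l → MossDefinable T l

module Submission where

-- Idea: every monotone predicate lifting λ over A = Fin k is determined by
-- its behaviour on one canonical one-step model, the set C = 𝒫(A) of
-- "colours" with the valuation Vc(a) = {c | a ∈ c}.  A point x of an
-- arbitrary model (X, V) has the colour {a | x ∈ V(a)}, and the formula
-- ψ_c = ⋀_{a ∈ c} a describes "having at least colour c".  Since T C is
-- finite, the disjunction
--     φ = ⋁ { ⟨γ⟩(ψ_c)_{c ∈ C}  |  γ ∈ T C,  γ ∈ λ_C(Vc) }
-- is a formula of 1ML, and it defines λ:
--   * if β ∈ λ_X(V), then γ = T(colour)(β) lies in λ_C(Vc) by naturality,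
--     and the graph of the colouring witnesses β ∈ ⟨γ⟩(ψ);
--   * if β ∈ ⟨γ⟩(ψ) with γ ∈ λ_C(Vc), then λ transfers along the Barr
--     relation witnessing this, by naturality along both projections.
-- Excluded middle is used to colour points and to select the γ's.

open import Level using (0ℓ)
open import Axiom.ExcludedMiddle using (ExcludedMiddle)
open import Defs
open import Data.Nat using (ℕ; zero; suc; _^_)
open import Data.Fin using (Fin; zero; suc; finToFun; funToFin)
open import Data.Fin.Properties using (finToFun-funToFin)
open import Data.Sum using (inj₁; inj₂)
open import Data.Product using (∃; _×_; _,_; proj₁; proj₂)
open import Data.Unit using (tt)
open import Data.Empty using (⊥-elim)
open import Relation.Nullary using (Dec; yes; no)
open import Relation.Unary using (Pred)
open import Relation.Binary.PropositionalEquality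
  using (_≡_; refl; sym; trans; subst; module ≡-Reasoning)
open import Function using (_∘_; id; _↔_; Inverse)
open import Function.Properties.Inverse using (↔-refl)

⋀ : {k m : ℕ} → (Fin m → Latt k) → Latt k
⋀ {m = zero}  f = ⊤L
⋀ {m = suc m} f = f zero ∧L ⋀ (f ∘ suc)

module _ {k : ℕ} {X : Set} (V : Fin k → Pred X 0ℓ) (x : X) where

  ⋀-elim : {m : ℕ} (f : Fin m → Latt k) →
           ⟦ ⋀ f ⟧L V x → (j : Fin m) → ⟦ f j ⟧L V x
  ⋀-elim f (p , _) zero    = p
  ⋀-elim f (_ , q) (suc j) = ⋀-elim (f ∘ suc) q j

  ⋀-intro : {m : ℕ} (f : Fin m → Latt k) →
            ((j : Fin m) → ⟦ f j ⟧L V x) → ⟦ ⋀ f ⟧L V x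
  ⋀-intro {zero}  f h = tt
  ⋀-intro {suc m} f h = h zero , ⋀-intro (f ∘ suc) (h ∘ suc)

⋁ : {T : SetFunctor} {k m : ℕ} → (Fin m → MossML T k) → MossML T k
⋁ {m = zero}  g = ⊥M
⋁ {m = suc m} g = g zero ∨M ⋁ (g ∘ suc)

guard : {T : SetFunctor} {k : ℕ} {P : Set} → Dec P → MossML T k → MossML T k
guard (yes _) φ = φ
guard (no _)  _ = ⊥M

⋁[_] : {T : SetFunctor} {k m : ℕ} {Y : Set} →
       Y ↔ Fin m → (Y → MossML T k) → MossML T k
⋁[ e ] g = ⋁ (g ∘ Inverse.from e)

module _ {T : SetFunctor} {k : ℕ} {X : Set} (β : F T X)
         (V : Fin k → Pred X 0ℓ) where

  ⋁-elim : {m : ℕ} (g : Fin m → MossML T k) →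
           X , β , V ⊩₁ ⋁ g → ∃ λ j → X , β , V ⊩₁ g j
  ⋁-elim {suc m} g (inj₁ p) = zero , p
  ⋁-elim {suc m} g (inj₂ q) with ⋁-elim (g ∘ suc) q
  ... | j , r = suc j , r

  ⋁-intro : {m : ℕ} (g : Fin m → MossML T k) (j : Fin m) →
            X , β , V ⊩₁ g j → X , β , V ⊩₁ ⋁ g
  ⋁-intro g zero    p = inj₁ p
  ⋁-intro g (suc j) p = inj₂ (⋁-intro (g ∘ suc) j p)

  ⋁[]-elim : {m : ℕ} {Y : Set} (e : Y ↔ Fin m) (g : Y → MossML T k) →
             X , β , V ⊩₁ ⋁[ e ] g → ∃ λ y → X , β , V ⊩₁ g y
  ⋁[]-elim e g s with ⋁-elim (g ∘ Inverse.from e) s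
  ... | j , r = Inverse.from e j , r

  ⋁[]-intro : {m : ℕ} {Y : Set} (e : Y ↔ Fin m) (g : Y → MossML T k) (y : Y) →
              X , β , V ⊩₁ g y → X , β , V ⊩₁ ⋁[ e ] g
  ⋁[]-intro e g y p = ⋁-intro (g ∘ Inverse.from e) (Inverse.to e y)
    (subst (λ y′ → X , β , V ⊩₁ g y′) (sym (Inverse.strictlyInverseʳ e y)) p)

  guard-elim : {P : Set} (d : Dec P) (φ : MossML T k) →
               X , β , V ⊩₁ guard d φ → P × (X , β , V ⊩₁ φ)
  guard-elim (yes p) φ s = p , s
  guard-elim (no _)  φ ()

  guard-intro : {P : Set} (d : Dec P) (φ : MossML T k) →
                P → X , β , V ⊩₁ φ → X , β , V ⊩₁ guard d φ
  guard-intro (yes _) φ _ s = s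
  guard-intro (no ¬p) φ p _ = ⊥-elim (¬p p)

-- Colours: subsets of A = Fin k, coded as elements of Fin (2 ^ k) through
-- the library bijection Fin (2 ^ k) ≅ (Fin k → Fin 2).

Colour : ℕ → Set
Colour k = Fin (2 ^ k)

_∈ᶜ_ : {k : ℕ} → Fin k → Colour k → Set
_∈ᶜ_ {k} a c = finToFun {2} {k} c a ≡ suc zero

χ : {P : Set} → Dec P → Fin 2
χ (yes _) = suc zero
χ (no _)  = zero

χ-sound : {P : Set} (d : Dec P) → χ d ≡ suc zero → P
χ-sound (yes p) _ = p

χ-complete : {P : Set} (d : Dec P) → P → χ d ≡ suc zero
χ-complete (yes _) _ = refl
χ-complete (no ¬p) p = ⊥-elim (¬p p)

module _ (em : ExcludedMiddle 0ℓ) {k : ℕ} (P : Fin k → Set) where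

  colourOf : Colour k
  colourOf = funToFin (λ a → χ (em {P a}))

  ∈-colourOf-sound : (a : Fin k) → a ∈ᶜ colourOf → P a
  ∈-colourOf-sound a e =
    χ-sound em (trans (sym (finToFun-funToFin (λ a → χ (em {P a})) a)) e)

  ∈-colourOf-complete : (a : Fin k) → P a → a ∈ᶜ colourOf
  ∈-colourOf-complete a p =
    trans (finToFun-funToFin (λ a → χ (em {P a})) a) (χ-complete em p)

literal : {k : ℕ} → Fin 2 → Fin k → Latt k
literal zero       a = ⊤L
literal (suc zero) a = var a

describe : {k : ℕ} → Colour k → Latt k
describe {k} c = ⋀ (λ a → literal (finToFun {2} {k} c a) a)

module _ {k : ℕ} {X : Set} (V : Fin k → Pred X 0ℓ) (x : X) where

  literal-sound : (b : Fin 2) (a : Fin k) →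
                  ⟦ literal b a ⟧L V x → b ≡ suc zero → V a x
  literal-sound (suc zero) a p refl = p

  literal-complete : (b : Fin 2) (a : Fin k) →
                     (b ≡ suc zero → V a x) → ⟦ literal b a ⟧L V x
  literal-complete zero       a h = tt
  literal-complete (suc zero) a h = h refl

  describe-sound : (c : Colour k) →
                   ⟦ describe c ⟧L V x → (a : Fin k) → a ∈ᶜ c → V a x
  describe-sound c p a =
    literal-sound (finToFun {2} {k} c a) a (⋀-elim V x _ p a)

  describe-complete : (c : Colour k) →
                      ((a : Fin k) → a ∈ᶜ c → V a x) → ⟦ describe c ⟧L V x
  describe-complete c h =
    ⋀-intro V x _ (λ a → literal-complete (finToFun {2} {k} c a) a (h a))

-- The graph of a map f : X → Y is contained in any relation R ⊆ X × Y that
-- holds along f; applying T to the graph shows β (T̄ R) (T f β).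
graph-Barr : (T : SetFunctor) {X Y : Set} (R : X → Y → Set) (f : X → Y) →
             ((x : X) → R x (f x)) → (β : F T X) → Barr T R β (fmap T f β)
graph-Barr T {X} R f onGraph β = fmap T graph β , first , second
  where
  open ≡-Reasoning
  graph : X → RelSet R
  graph x = (x , f x) , onGraph x
  first : fmap T (proj₁ ∘ proj₁) (fmap T graph β) ≡ β
  first = begin
    fmap T (proj₁ ∘ proj₁) (fmap T graph β) ≡⟨ sym (fmap-∘ T graph _ β) ⟩
    fmap T (proj₁ ∘ proj₁ ∘ graph) β        ≡⟨ fmap-cong T (λ _ → refl) β ⟩
    fmap T id β                             ≡⟨ fmap-id T β ⟩
    β                                       ∎
  second : fmap T (proj₂ ∘ proj₁) (fmap T graph β) ≡ fmap T f β
  second = sym (fmap-∘ T graph _ β)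

module _ {T : SetFunctor} {k : ℕ} (l : PredLifting T k) (mono : Monotone l) where

  push : {X Y : Set} (f : X → Y) {V : Fin k → Pred X 0ℓ} {W : Fin k → Pred Y 0ℓ} →
         ((a : Fin k) (x : X) → V a x → W a (f x)) →
         (t : F T X) → lift l V t → lift l W (fmap T f t)
  push f {V} {W} V⊆f⁻¹W t p = proj₁ (natural l f W t) (mono V _ V⊆f⁻¹W t p)

  pull : {X Y : Set} (f : X → Y) {V : Fin k → Pred X 0ℓ} {W : Fin k → Pred Y 0ℓ} →
         ((a : Fin k) (x : X) → W a (f x) → V a x) →
         (t : F T X) → lift l W (fmap T f t) → lift l V t
  pull f {V} {W} f⁻¹W⊆V t p = mono _ V f⁻¹W⊆V t (proj₂ (natural l f W t) p)

  -- If β (T̄ R) γ and every R-predecessor of a point in W(a) lies in V(a),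
  -- then γ ∈ λ(W) implies β ∈ λ(V): pull back along the second projection
  -- of R and push forward along the first.
  Barr-transfer : {X Y : Set} (R : X → Y → Set)
                  {V : Fin k → Pred X 0ℓ} {W : Fin k → Pred Y 0ℓ} →
                  ((a : Fin k) (x : X) (y : Y) → R x y → W a y → V a x) →
                  {β : F T X} {γ : F T Y} → Barr T R β γ →
                  lift l W γ → lift l V β
  Barr-transfer R {V} {W} R⁻¹W⊆V (ρ , refl , refl) p =
    push (proj₁ ∘ proj₁) (λ a r → R⁻¹W⊆V a _ _ (proj₂ r)) ρ
      (pull (proj₂ ∘ proj₁) {V = λ a r → W a (proj₂ (proj₁ r))} (λ _ _ w → w) ρ p)

module Canonical (em : ExcludedMiddle 0ℓ) (T : SetFunctor)
                 (finite : PreservesFiniteSets T)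
                 {k : ℕ} (l : PredLifting T k) (mono : Monotone l) where

  Vc : Fin k → Pred (Colour k) 0ℓ
  Vc a c = a ∈ᶜ c

  finiteTC : IsFinite (F T (Colour k))
  finiteTC = finite (Colour k) (2 ^ k , ↔-refl)

  disjunct : F T (Colour k) → MossML T k
  disjunct γ = guard (em {lift l Vc γ}) (mossM (2 ^ k) γ describe)

  formula : MossML T k
  formula = ⋁[ proj₂ finiteTC ] disjunct

  module _ (X : Set) (β : F T X) (V : Fin k → Pred X 0ℓ) where

    colour : X → Colour k
    colour x = colourOf em (λ a → V a x)

    Describes : X → Colour k → Set
    Describes x c = ⟦ describe c ⟧L V x

    formula-complete : lift l V β → X , β , V ⊩₁ formula
    formula-complete p =
      ⋁[]-intro β V (proj₂ finiteTC) disjunct γ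
        (guard-intro β V (em {lift l Vc γ}) (mossM (2 ^ k) γ describe) γ∈λVc β∈⟨γ⟩)
      where
      γ : F T (Colour k)
      γ = fmap T colour β
      γ∈λVc : lift l Vc γ
      γ∈λVc = push l mono colour
        (λ a x → ∈-colourOf-complete em (λ a → V a x) a) β p
      β∈⟨γ⟩ : Barr T Describes β γ
      β∈⟨γ⟩ = graph-Barr T Describes colour
        (λ x → describe-complete V x (colour x)
                 (∈-colourOf-sound em (λ a → V a x))) β

    formula-sound : X , β , V ⊩₁ formula → lift l V β
    formula-sound s with ⋁[]-elim β V (proj₂ finiteTC) disjunct s
    ... | γ , s′ with guard-elim β V (em {lift l Vc γ}) (mossM (2 ^ k) γ describe) s′
    ... | γ∈λVc , β∈⟨γ⟩ =
      Barr-transfer l mono Describes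
        (λ a x c ψc → describe-sound V x c ψc a) β∈⟨γ⟩ γ∈λVc

proposition3p18 : ExcludedMiddle 0ℓ → (T : SetFunctor) →
    PreservesWeakPullbacks T → PreservesFiniteSets T →
    MossExpressivelyComplete T
proposition3p18 em T _ finite k l mono =
  formula , λ X β V → formula-complete X β V , formula-sound X β V
  where open Canonical em T finite l mono
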